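{- For all integers $k\ge 1$ and $n\ge 1$, $$a_k(n)\ =\ a_{k-1}(n+2) - \binom{n+k}{k-1},$$ equivalently, $$\sum_{m=1}^n a_{k-1}(m) \ =\ a_{k-1}(n+2) - \binom{n+k}{k-1}.$$
   Context: Let $(F_n)_{n\ge 1}$ be the Fibonacci sequence with $F_1=F_2=1$ and $F_{n+2}=F_{n+1}+F_n$ for $n\ge 1$. Define $a_0(n)=F_n$ for $n\ge 1$, and for $k\ge 1$ define $a_k(n)=\sum_{i=1}^n a_{k-1}(i)$ for $n\ge 1$. Thus $(a_k(n))_{n\ge1}$ is the sequence obtained by applying the partial-sum operator $k$ times to the Fibonacci sequence. -}

module Defs where

open import Data.Nat using (ℕ; zero; suc; _+_)

F : ℕ → ℕ
F zero = 0
F (suc zero) = 1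
F (suc (suc n)) = F (suc n) + F n

sum1 : (ℕ → ℕ) → ℕ → ℕ
sum1 f zero = 0
sum1 f (suc n) = sum1 f n + f (suc n)

-- a k n : k-fold partial sums of Fibonacci; meaningful for n ≥ 1
a : ℕ → ℕ → ℕ
a zero n = F n
a (suc k) n = sum1 (a k) n

-- Unfolding the last partial sum, a (1+j) (1+n) = a (1+j) n + a j (1+n),
-- so the identity propagates by induction on n along Pascal's rule
-- C(j+n+2, j) + C(j+n+2, j+1) = C(j+n+3, j+1); the base cases are
-- n = 0, where a (1+j) 2 = j + 2 = C(j+2, j+1), and j = 0, which is the
-- classical F 1 + ⋯ + F n = F (n+2) − 1.
module Submission where

open import Defs
open import Data.Nat using (ℕ; zero; suc; _+_; _∸_; _≥_)
open import Data.Nat.Combinatorics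
  using (_C_; nCk≡nC[n∸k]; nC1≡n; nCk+nC[k+1]≡[n+1]C[k+1])
open import Data.Nat.Properties
  using (+-comm; +-suc; n≤1+n; m+n∸n≡m; +-commutativeSemigroup)
open import Data.Nat.Solver using (module +-*-Solver)
open import Algebra.Properties.CommutativeSemigroup +-commutativeSemigroup
  using (xy∙z≈xz∙y)
open import Relation.Binary.PropositionalEquality
open ≡-Reasoning
open +-*-Solver using (solve; _:+_; _:=_)

[1+n]Cn≡1+n : ∀ n → suc n C n ≡ suc n
[1+n]Cn≡1+n n = begin
  suc n C n             ≡⟨ nCk≡nC[n∸k] (n≤1+n n) ⟩
  suc n C (suc n ∸ n)   ≡⟨ cong (suc n C_) (m+n∸n≡m 1 n) ⟩
  suc n C 1             ≡⟨ nC1≡n (suc n) ⟩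
  suc n                 ∎

sum1F+1≡F[2+n] : ∀ n → sum1 F n + 1 ≡ F (2 + n)
sum1F+1≡F[2+n] zero    = refl
sum1F+1≡F[2+n] (suc n) = begin
  sum1 F n + F (1 + n) + 1   ≡⟨ xy∙z≈xz∙y (sum1 F n) (F (1 + n)) 1 ⟩
  sum1 F n + 1 + F (1 + n)   ≡⟨ cong (_+ F (1 + n)) (sum1F+1≡F[2+n] n) ⟩
  F (2 + n) + F (1 + n)      ∎

a[j,1]≡1 : ∀ j → a j 1 ≡ 1
a[j,1]≡1 zero    = refl
a[j,1]≡1 (suc j) = a[j,1]≡1 j

a[j,2]≡1+j : ∀ j → a j 2 ≡ suc j
a[j,2]≡1+j zero    = refl
a[j,2]≡1+j (suc j) = cong₂ _+_ (a[j,1]≡1 j) (a[j,2]≡1+j j)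

a[1+j,n]+[1+j+n]Cj≡a[j,2+n] : ∀ j n → a (suc j) n + (suc j + n) C j ≡ a j (2 + n)
-- (1 + n) C 0 computes to 1.
a[1+j,n]+[1+j+n]Cj≡a[j,2+n] zero n = sum1F+1≡F[2+n] n
a[1+j,n]+[1+j+n]Cj≡a[j,2+n] (suc j) zero = begin
  (2 + j + 0) C (suc j)   ≡⟨ cong (λ m → (2 + m) C suc j) (+-comm j 0) ⟩
  (2 + j) C (suc j)       ≡⟨ [1+n]Cn≡1+n (suc j) ⟩
  2 + j                   ≡⟨ sym (cong₂ _+_ (a[j,1]≡1 j) (a[j,2]≡1+j j)) ⟩
  a j 1 + a j 2           ∎
a[1+j,n]+[1+j+n]Cj≡a[j,2+n] (suc j) (suc n) = begin
  (A + B) + (2 + j + suc n) C (suc j)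
    ≡⟨ cong ((A + B) +_) (sym (nCk+nC[k+1]≡[n+1]C[k+1] (suc j + suc n) j)) ⟩
  (A + B) + (X + (suc j + suc n) C suc j)
    ≡⟨ cong (λ m → (A + B) + (X + suc m C suc j)) (+-suc j n) ⟩
  (A + B) + (X + Y)
    ≡⟨ solve 4 (λ A B X Y → (A :+ B) :+ (X :+ Y) := (A :+ Y) :+ (B :+ X)) refl A B X Y ⟩
  (A + Y) + (B + X)
    ≡⟨ cong₂ _+_ (a[1+j,n]+[1+j+n]Cj≡a[j,2+n] (suc j) n)
                 (a[1+j,n]+[1+j+n]Cj≡a[j,2+n] j (suc n)) ⟩
  a (suc j) (2 + n) + a j (3 + n)
    ∎
  where
  A = a (2 + j) n
  B = a (suc j) (suc n)
  X = (suc j + suc n) C j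
  Y = (2 + j + n) C suc j

theorem1p1 : ∀ (k n : ℕ) → k ≥ 1 → n ≥ 1 →
    a k n + (n + k) C (k ∸ 1) ≡ a (k ∸ 1) (n + 2)
theorem1p1 (suc j) n _ _ rewrite +-comm n (suc j) | +-comm n 2 =
  a[1+j,n]+[1+j+n]Cj≡a[j,2+n] j n
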